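{- Let $H_C$ be the ordered graph on vertex set $\{1,2,3,4\}$ with edge set $\{\{1,4\},\{2,3\}\}$ (an ordering of $K_2\cup K_2$). Then $r_<(H_C)=6$.
   Context: An ordered graph on $n$ vertices is a graph with vertex set $[n]=\{1,\dots,n\}$ equipped with the natural order. Given an ordered graph $H$ on $[n]$ and a red/blue coloring of the edges of the complete graph $K_N$ on vertex set $[N]$, a monochromatic ordered copy of $H$ is a strictly increasing map $\phi:[n]\to[N]$ such that all edges $\{\phi(i),\phi(j)\}$ with $\{i,j\}\in E(H)$ receive the same color. The ordered Ramsey number $r_<(H)$ is the least $N$ such that every red/blue coloring of the edges of the complete graph on $[N]$ contains a monochromatic ordered copy of $H$. -}

module Defs where

open import Data.Nat using (ℕ)
import Data.Nat as ℕ
open import Data.Fin using (Fin; zero; suc; _<_)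
open import Data.Fin.Patterns
open import Data.Bool using (Bool)
open import Data.List using (List; []; _∷_)
open import Data.List.Relation.Unary.All using (All)
open import Data.Product using (Σ; ∃; _×_; _,_)
open import Relation.Binary.PropositionalEquality using (_≡_)
open import Relation.Nullary using (¬_)

record Edge (n : ℕ) : Set where
  constructor edge
  field
    lo hi : Fin n
    lo<hi : lo < hi

OrderedGraph : ℕ → Set
OrderedGraph n = List (Edge n)

-- A red/blue colouring of the edges of K_N on [N]: the colour of the edge {a,b}
-- with a < b is χ a b (values with a ≥ b are irrelevant).
Colouring : ℕ → Set
Colouring N = Fin N → Fin N → Bool

StrictlyIncreasing : ∀ {n N} → (Fin n → Fin N) → Set
StrictlyIncreasing φ = ∀ i j → i < j → φ i < φ j

MonoCopy : ∀ {n N} → OrderedGraph n → Colouring N → Set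
MonoCopy {n} {N} H χ =
  Σ (Fin n → Fin N) λ φ → StrictlyIncreasing φ ×
    Σ Bool λ c → All (λ e → χ (φ (Edge.lo e)) (φ (Edge.hi e)) ≡ c) H

Arrows : ∀ {n} → ℕ → OrderedGraph n → Set
Arrows N H = (χ : Colouring N) → MonoCopy H χ

IsOrderedRamseyNumber : ∀ {n} → OrderedGraph n → ℕ → Set
IsOrderedRamseyNumber H N = Arrows N H × (∀ M → M ℕ.< N → ¬ Arrows M H)

-- H_C on {1,2,3,4} with edges {1,4},{2,3}; vertex k is Fin index k-1.
H-C : OrderedGraph 4
H-C = edge 0F 3F (ℕ.s≤s ℕ.z≤n)
    ∷ edge 1F 2F (ℕ.s≤s (ℕ.s≤s ℕ.z≤n))
    ∷ []

-- Upper bound: among the three nested pairs {2,5}, {3,4}, {1,6} of [6] two have the same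
-- colour, and any two nested pairs span an ordered copy of H_C.  Lower bound: colour an
-- edge of K_5 red iff both endpoints lie in {2,3,4}.  The inner pair of a copy always lies
-- there, but the outer pair cannot, since it spans at least four vertices.
module Submission where

open import Defs
open import Data.Nat as ℕ using (s≤s; z≤n)
import Data.Nat.Properties as ℕP
open import Data.Fin using (Fin; _<_; toℕ; inject≤)
open import Data.Fin.Patterns
open import Data.Fin.Properties using (toℕ-inject≤; toℕ≤pred[n])
import Data.Fin.Properties as FinP
open import Data.Bool using (Bool; true; false; _∧_)
open import Data.List.Relation.Unary.All using ([]; _∷_)
open import Data.Product using (_,_)
open import Data.Sum using (_⊎_; inj₁; inj₂)
open import Function using (_∘_)
open import Relation.Binary.PropositionalEquality using (_≡_; refl; sym; trans; cong₂; subst₂; _≢_)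
open import Relation.Nullary using (¬_; Dec; does; yes; no)
open import Relation.Nullary.Decidable using (dec-true; dec-false; from-yes)

Arrows-mono : ∀ {n M N} {H : OrderedGraph n} → M ℕ.≤ N → Arrows M H → Arrows N H
Arrows-mono {M = M} {N} {H} M≤N arrows χ = push (arrows (λ a b → χ (ι a) (ι b)))
  where
  ι : Fin M → Fin N
  ι a = inject≤ a M≤N
  ι-mono : ∀ {a b} → a < b → ι a < ι b
  ι-mono {a} {b} = subst₂ ℕ._<_ (sym (toℕ-inject≤ a M≤N)) (sym (toℕ-inject≤ b M≤N))
  push : MonoCopy H (λ a b → χ (ι a) (ι b)) → MonoCopy H χ
  push (φ , φ-inc , c , mono) = ι ∘ φ , (λ i j → ι-mono ∘ φ-inc i j) , c , mono

nested-copy : ∀ {N} (χ : Colouring N) (a b c d : Fin N) →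
              a < b → b < c → c < d → χ a d ≡ χ b c → MonoCopy H-C χ
nested-copy χ a b c d a<b b<c c<d same = φ , φ-inc , χ b c , same ∷ refl ∷ []
  where
  φ : Fin 4 → Fin _
  φ 0F = a
  φ 1F = b
  φ 2F = c
  φ 3F = d
  φ-inc : StrictlyIncreasing φ
  φ-inc 0F 1F _ = a<b
  φ-inc 0F 2F _ = FinP.<-trans a<b b<c
  φ-inc 0F 3F _ = FinP.<-trans a<b (FinP.<-trans b<c c<d)
  φ-inc 1F 2F _ = b<c
  φ-inc 1F 3F _ = FinP.<-trans b<c c<d
  φ-inc 2F 3F _ = c<d
  φ-inc 0F 0F ()
  φ-inc 1F 0F ()
  φ-inc 1F 1F (s≤s ())
  φ-inc 2F 0F ()
  φ-inc 2F 1F (s≤s ())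
  φ-inc 2F 2F (s≤s (s≤s ()))
  φ-inc 3F 0F ()
  φ-inc 3F 1F (s≤s ())
  φ-inc 3F 2F (s≤s (s≤s ()))
  φ-inc 3F 3F (s≤s (s≤s (s≤s ())))

two-of-three-equal : (x y z : Bool) → x ≡ y ⊎ z ≡ x ⊎ z ≡ y
two-of-three-equal false false _     = inj₁ refl
two-of-three-equal true  true  _     = inj₁ refl
two-of-three-equal false true  false = inj₂ (inj₁ refl)
two-of-three-equal true  false true  = inj₂ (inj₁ refl)
two-of-three-equal false true  true  = inj₂ (inj₂ refl)
two-of-three-equal true  false false = inj₂ (inj₂ refl)

arrows-6 : Arrows 6 H-C
arrows-6 χ with two-of-three-equal (χ 1F 4F) (χ 2F 3F) (χ 0F 5F)
... | inj₁ 14≡23 =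
  nested-copy χ 1F 2F 3F 4F (from-yes (1 ℕ.<? 2)) (from-yes (2 ℕ.<? 3)) (from-yes (3 ℕ.<? 4)) 14≡23
... | inj₂ (inj₁ 05≡14) =
  nested-copy χ 0F 1F 4F 5F (from-yes (0 ℕ.<? 1)) (from-yes (1 ℕ.<? 4)) (from-yes (4 ℕ.<? 5)) 05≡14
... | inj₂ (inj₂ 05≡23) =
  nested-copy χ 0F 2F 3F 5F (from-yes (0 ℕ.<? 2)) (from-yes (2 ℕ.<? 3)) (from-yes (3 ℕ.<? 5)) 05≡23

χ₅ : Colouring 5
χ₅ a b = does (1 ℕ.≤? toℕ a) ∧ does (toℕ b ℕ.<? 4)

<-<-<⇒3+≤ : ∀ {a b c d} → a ℕ.< b → b ℕ.< c → c ℕ.< d → 3 ℕ.+ a ℕ.≤ d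
<-<-<⇒3+≤ a<b b<c c<d = ℕP.≤-trans (s≤s (s≤s a<b)) (ℕP.≤-trans (s≤s b<c) c<d)

χ₅-inner-red : ∀ {a b c d : Fin 5} → a < b → c < d → χ₅ b c ≡ true
χ₅-inner-red {b = b} {c} {d} a<b c<d =
  cong₂ _∧_ (dec-true (1 ℕ.≤? toℕ b) (ℕP.≤-trans (s≤s z≤n) a<b))
            (dec-true (toℕ c ℕ.<? 4) (ℕP.<-≤-trans c<d (toℕ≤pred[n] d)))

χ₅-outer-blue : ∀ {a b c d : Fin 5} → a < b → b < c → c < d → χ₅ a d ≡ false
χ₅-outer-blue {a} {d = d} a<b b<c c<d = by-cases (1 ℕ.≤? toℕ a)
  where
  by-cases : (1≤a? : Dec (1 ℕ.≤ toℕ a)) → does 1≤a? ∧ does (toℕ d ℕ.<? 4) ≡ false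
  by-cases (no _)    = refl
  by-cases (yes 1≤a) = dec-false (toℕ d ℕ.<? 4) λ d<4 →
    ℕP.<⇒≱ d<4 (ℕP.≤-trans (ℕP.+-monoʳ-≤ 3 1≤a) (<-<-<⇒3+≤ a<b b<c c<d))

χ₅-nested-differ : ∀ {a b c d : Fin 5} → a < b → b < c → c < d → χ₅ a d ≢ χ₅ b c
χ₅-nested-differ a<b b<c c<d same
  with trans (sym (χ₅-outer-blue a<b b<c c<d)) (trans same (χ₅-inner-red a<b c<d))
... | ()

¬arrows-5 : ¬ Arrows 5 H-C
¬arrows-5 arrows with arrows χ₅
... | φ , φ-inc , _ , outer ∷ inner ∷ [] =
  χ₅-nested-differ (φ-inc 0F 1F (s≤s z≤n)) (φ-inc 1F 2F (s≤s (s≤s z≤n)))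
                   (φ-inc 2F 3F (s≤s (s≤s (s≤s z≤n)))) (trans outer (sym inner))

proposition2p3 : IsOrderedRamseyNumber H-C 6
proposition2p3 = arrows-6 , λ M M<6 arrows → ¬arrows-5 (Arrows-mono (ℕP.≤-pred M<6) arrows)
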